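{- The graphs $T_1$ and $T_2$ are not word-representable, where both have vertex set $\{1,\dots,9\}$ and contain the edges of the $3\times 3$ grid graph $\{1,2\},\{2,3\},\{4,5\},\{5,6\},\{7,8\},\{8,9\},\{1,4\},\{4,7\},\{2,5\},\{5,8\},\{3,6\},\{6,9\}$, and in addition $T_1$ has the edges $\{5,7\},\{2,4\},\{6,8\},\{2,6\}$, while $T_2$ has the edges $\{4,8\},\{1,5\},\{5,9\},\{3,5\}$.
   Context: Vertices $1,\dots,9$ are positions in a $3\times 3$ array, rows $1,2,3$ / $4,5,6$ / $7,8,9$ from top to bottom, each read left to right; the additional edges are one diagonal in each of the four unit squares, so $T_1,T_2$ are triangulations of the $3\times3$ grid graph. A graph $G=(V,E)$ is word-representable if there is a word $w$ over the alphabet $V$ such that for all distinct $x,y\in V$, the letters $x$ and $y$ alternate in $w$ if and only if $\{x,y\}\in E$. -}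

module Defs where

open import Data.Nat using (ℕ)
open import Data.Fin using (Fin)
open import Data.Fin.Patterns
open import Data.Bool using (Bool; true; false)
open import Data.List using (List; []; _∷_; filter)
open import Data.List.Membership.Propositional using (_∈_)
open import Data.Product using (Σ; _×_)
open import Data.Sum using (_⊎_)
open import Relation.Nullary using (¬_; yes; no)
open import Relation.Binary.PropositionalEquality using (_≡_)
open import Data.Fin.Properties using (_≟_)
open import Relation.Nullary.Decidable using (_⊎-dec_)
open import Function using (_⇔_)

record Graph (n : ℕ) : Set₁ where
  field
    Adj : Fin n → Fin n → Set

open Graph public

restrict : {n : ℕ} → Fin n → Fin n → List (Fin n) → List (Fin n)
restrict x y = filter (λ z → (z ≟ x) ⊎-dec (z ≟ y))

data AltFrom {n : ℕ} (a b : Fin n) : List (Fin n) → Set where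
  alt-[] : AltFrom a b []
  alt-∷  : {u : List (Fin n)} → AltFrom b a u → AltFrom a b (a ∷ u)

Alternate : {n : ℕ} → List (Fin n) → Fin n → Fin n → Set
Alternate w x y = AltFrom x y (restrict x y w) ⊎ AltFrom y x (restrict x y w)

Represents : {n : ℕ} → Graph n → List (Fin n) → Set
Represents {n} G w =
  ((x : Fin n) → x ∈ w) ×
  ((x y : Fin n) → ¬ (x ≡ y) → (Alternate w x y ⇔ (Adj G x y ⊎ Adj G y x)))

WordRepresentable : {n : ℕ} → Graph n → Set
WordRepresentable {n} G = Σ (List (Fin n)) (Represents G)

-- Vertices 1..9 are encoded as 0F..8F (vertex k ↦ k - 1).
-- Edge lists, each edge listed once as an ordered pair; adjacency is
-- symmetrised in Represents.
data GridE : Fin 9 → Fin 9 → Set where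
  e12 : GridE 0F 1F
  e23 : GridE 1F 2F
  e45 : GridE 3F 4F
  e56 : GridE 4F 5F
  e78 : GridE 6F 7F
  e89 : GridE 7F 8F
  e14 : GridE 0F 3F
  e47 : GridE 3F 6F
  e25 : GridE 1F 4F
  e58 : GridE 4F 7F
  e36 : GridE 2F 5F
  e69 : GridE 5F 8F

data T₁E : Fin 9 → Fin 9 → Set where
  grid : {x y : Fin 9} → GridE x y → T₁E x y
  e57 : T₁E 4F 6F
  e24 : T₁E 1F 3F
  e68 : T₁E 5F 7F
  e26 : T₁E 1F 5F

data T₂E : Fin 9 → Fin 9 → Set where
  grid : {x y : Fin 9} → GridE x y → T₂E x y
  e48 : T₂E 3F 7F
  e15 : T₂E 0F 4F
  e59 : T₂E 4F 8F
  e35 : T₂E 2F 4F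

T₁ : Graph 9
T₁ = record { Adj = T₁E }

T₂ : Graph 9
T₂ = record { Adj = T₂E }

module Submission where

-- T₁ and T₂ are not word-representable because each contains an odd wheel:
-- vertex 5 is adjacent to every vertex of an induced cycle of odd length
-- (2 – 4 – 7 – 8 – 6 in T₁, 1 – 2 – 3 – 6 – 9 – 8 – 4 in T₂).
--
-- For a word w and letters c, x, y, the orientation  orient c x y w  records whether
-- the first two letters of w restricted to {c, x, y} follow the cyclic order c → x → y.
-- The key fact (orientation-flips) is the transitivity of this orientation: if c
-- alternates with a and d, a – b – d alternate pairwise but a, d do not, then the
-- triples (c, a, b) and (c, b, d) receive different orientations.  Around an odd wheel
-- the orientations of consecutive rim edges would therefore alternate along a cycle of
-- odd length, which is impossible (no-odd-wheel).
--
-- The key fact only depends on which letters of w equal c, a, b, d, so it reduces to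
-- words over five letters (relabelling).  There it is a property of a finite automaton
-- that tracks alternation of the relevant pairs (scan) and the orientations (lead); it
-- is verified by computing the set of reachable automaton states and checking that it
-- is closed under every letter and that each of its states satisfies the claim.

open import Defs
open import Data.Product using (_×_)
open import Relation.Nullary using (¬_)

open import Data.Bool using (Bool; true; false; if_then_else_)
open import Data.Bool.Properties using (¬-not)
import Data.Bool.Properties as Bool
open import Data.Empty using (⊥-elim)
open import Data.Fin using (Fin; zero; suc; inject₁)
open import Data.Fin.Patterns
open import Data.Fin.Properties using (_≟_; suc-injective; 0≢1+n)
open import Data.List using (List; []; _∷_; _++_; _∷ʳ_; map; length; allFin; filter; deduplicate; concatMap)
open import Data.List.Properties using (filter-accept; filter-reject; length-++)
import Data.List.Properties as List
open import Data.List.Relation.Unary.All using (All; all?)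
import Data.List.Relation.Unary.All as All
open import Data.List.Relation.Unary.Linked using (Linked; []; [-]; _∷_)
open import Data.List.Membership.Propositional.Properties using (∈-allFin)
open import Data.Maybe using (Maybe; just; nothing)
open import Data.Nat using (ℕ; zero; suc; _+_; parity)
open import Data.Nat.Properties using (+-comm)
open import Data.Parity.Base using (1ℙ)
open import Data.Product using (_,_; proj₂)
import Data.Product.Properties as Product
open import Data.Sum using (_⊎_; inj₁; inj₂)
open import Data.Unit using (⊤; tt)
open import Data.Vec using (Vec; []; _∷_; lookup)
open import Data.Vec.Relation.Unary.All using ([]; _∷_)
open import Data.Vec.Relation.Unary.All.Properties using (lookup⁺)
open import Data.Vec.Relation.Unary.AllPairs using (AllPairs; []; _∷_)
open import Function using (_∘_; _⇔_; mk⇔; Equivalence)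
open import Relation.Binary.Definitions using (DecidableEquality)
open import Relation.Binary.PropositionalEquality
  using (_≡_; _≢_; refl; sym; trans; cong; cong₂; subst; subst₂; ≢-sym; module ≡-Reasoning)
open import Relation.Nullary using (Dec; yes; no; does)
open import Relation.Nullary.Decidable
  using (dec-true; dec-false; toWitness; decidable-stable; ¬?; _×-dec_; _→-dec_; _⊎-dec_)

-- What is known about the restriction of a word to a pair {x, y}: it is empty, it
-- alternates starting with x, it alternates starting with y, or it does not alternate.
data Scan : Set where
  none startsX startsY broken : Scan

_≟ₛ_ : DecidableEquality Scan
none    ≟ₛ none    = yes refl
none    ≟ₛ startsX = no λ ()
none    ≟ₛ startsY = no λ ()
none    ≟ₛ broken  = no λ ()
startsX ≟ₛ none    = no λ ()
startsX ≟ₛ startsX = yes refl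
startsX ≟ₛ startsY = no λ ()
startsX ≟ₛ broken  = no λ ()
startsY ≟ₛ none    = no λ ()
startsY ≟ₛ startsX = no λ ()
startsY ≟ₛ startsY = yes refl
startsY ≟ₛ broken  = no λ ()
broken  ≟ₛ none    = no λ ()
broken  ≟ₛ startsX = no λ ()
broken  ≟ₛ startsY = no λ ()
broken  ≟ₛ broken  = yes refl

data Side : Set where
  onX onY off : Side

-- Prepending one letter: a repeated first letter breaks alternation for good.
push : Side → Scan → Scan
push off s       = s
push onX none    = startsX
push onX startsX = broken
push onX startsY = startsX
push onX broken  = broken
push onY none    = startsY
push onY startsX = startsY
push onY startsY = broken
push onY broken  = broken

push-broken : ∀ r → push r broken ≡ broken
push-broken onX = refl
push-broken onY = refl
push-broken off = refl

cyclic : List (Fin 3) → Bool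
cyclic (0F ∷ 1F ∷ _) = true
cyclic (1F ∷ 2F ∷ _) = true
cyclic (2F ∷ 0F ∷ _) = true
cyclic _             = false

-- Prepending a (possibly absent) letter to a list that only remembers its first two letters.
remember : Maybe (Fin 3) → List (Fin 3) → List (Fin 3)
remember nothing  l       = l
remember (just i) []      = i ∷ []
remember (just i) (j ∷ _) = i ∷ j ∷ []

module _ {n : ℕ} where

  side : Fin n → Fin n → Fin n → Side
  side x y z = if does (z ≟ x) then onX else if does (z ≟ y) then onY else off

  scan : Fin n → Fin n → List (Fin n) → Scan
  scan x y []      = none
  scan x y (z ∷ w) = push (side x y z) (scan x y w)

  rank : Fin n → Fin n → Fin n → Fin n → Maybe (Fin 3)
  rank c x y z =
    if does (z ≟ c) then just 0F else
    if does (z ≟ x) then just 1F else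
    if does (z ≟ y) then just 2F else nothing

  lead : Fin n → Fin n → Fin n → List (Fin n) → List (Fin 3)
  lead c x y []      = []
  lead c x y (z ∷ w) = remember (rank c x y z) (lead c x y w)

  orient : Fin n → Fin n → Fin n → List (Fin n) → Bool
  orient c x y w = cyclic (lead c x y w)

alt-head : ∀ {n} {a b c : Fin n} {l} → AltFrom a b (c ∷ l) → a ≡ c
alt-head (alt-∷ _) = refl

alt-tail : ∀ {n} {a b c : Fin n} {l} → AltFrom a b (c ∷ l) → AltFrom b a l
alt-tail (alt-∷ h) = h

module ScanCorrect {n : ℕ} {x y : Fin n} (x≢y : x ≢ y) where

  data Letter : Fin n → Set where
    at-x      : Letter x
    at-y      : Letter y
    elsewhere : ∀ {z} → z ≢ x → z ≢ y → Letter z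

  letter : ∀ z → Letter z
  letter z with z ≟ x | z ≟ y
  ... | yes refl | _        = at-x
  ... | no _     | yes refl = at-y
  ... | no z≢x   | no z≢y   = elsewhere z≢x z≢y

  side-x : side x y x ≡ onX
  side-x rewrite dec-true (x ≟ x) refl = refl

  side-y : side x y y ≡ onY
  side-y rewrite dec-false (y ≟ x) (≢-sym x≢y) | dec-true (y ≟ y) refl = refl

  side-elsewhere : ∀ {z} → z ≢ x → z ≢ y → side x y z ≡ off
  side-elsewhere {z} z≢x z≢y rewrite dec-false (z ≟ x) z≢x | dec-false (z ≟ y) z≢y = refl

  restrict-x : ∀ w → restrict x y (x ∷ w) ≡ x ∷ restrict x y w
  restrict-x w = filter-accept (λ z → (z ≟ x) ⊎-dec (z ≟ y)) (inj₁ refl)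

  restrict-y : ∀ w → restrict x y (y ∷ w) ≡ y ∷ restrict x y w
  restrict-y w = filter-accept (λ z → (z ≟ x) ⊎-dec (z ≟ y)) (inj₂ refl)

  restrict-elsewhere : ∀ {z} → z ≢ x → z ≢ y → ∀ w → restrict x y (z ∷ w) ≡ restrict x y w
  restrict-elsewhere z≢x z≢y w =
    filter-reject (λ z → (z ≟ x) ⊎-dec (z ≟ y)) λ { (inj₁ z≡x) → z≢x z≡x ; (inj₂ z≡y) → z≢y z≡y }

  Describes : Scan → List (Fin n) → Set
  Describes none    l = l ≡ []
  Describes startsX l = AltFrom x y l
  Describes startsY l = AltFrom y x l
  Describes broken  l = ⊤

  describes-x : ∀ s {l} → Describes s l → Describes (push onX s) (x ∷ l)
  describes-x none    refl = alt-∷ alt-[]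
  describes-x startsX _    = tt
  describes-x startsY h    = alt-∷ h
  describes-x broken  _    = tt

  describes-y : ∀ s {l} → Describes s l → Describes (push onY s) (y ∷ l)
  describes-y none    refl = alt-∷ alt-[]
  describes-y startsX h    = alt-∷ h
  describes-y startsY _    = tt
  describes-y broken  _    = tt

  scan-sound : ∀ w → Describes (scan x y w) (restrict x y w)
  scan-sound []      = refl
  scan-sound (z ∷ w) with letter z
  ... | at-x rewrite side-x | restrict-x w = describes-x (scan x y w) (scan-sound w)
  ... | at-y rewrite side-y | restrict-y w = describes-y (scan x y w) (scan-sound w)
  ... | elsewhere z≢x z≢y rewrite side-elsewhere z≢x z≢y | restrict-elsewhere z≢x z≢y w = scan-sound w

  push-x : ∀ {s} → s ≡ none ⊎ s ≡ startsY → push onX s ≡ startsX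
  push-x (inj₁ refl) = refl
  push-x (inj₂ refl) = refl

  push-y : ∀ {s} → s ≡ none ⊎ s ≡ startsX → push onY s ≡ startsY
  push-y (inj₁ refl) = refl
  push-y (inj₂ refl) = refl

  scan-completeˣ : ∀ w → AltFrom x y (restrict x y w) → scan x y w ≡ none ⊎ scan x y w ≡ startsX
  scan-completeʸ : ∀ w → AltFrom y x (restrict x y w) → scan x y w ≡ none ⊎ scan x y w ≡ startsY

  scan-completeˣ []      _ = inj₁ refl
  scan-completeˣ (z ∷ w) h with letter z
  ... | at-x rewrite side-x | restrict-x w = inj₂ (push-x (scan-completeʸ w (alt-tail h)))
  ... | at-y rewrite restrict-y w = ⊥-elim (x≢y (alt-head h))
  ... | elsewhere z≢x z≢y rewrite side-elsewhere z≢x z≢y | restrict-elsewhere z≢x z≢y w = scan-completeˣ w h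

  scan-completeʸ []      _ = inj₁ refl
  scan-completeʸ (z ∷ w) h with letter z
  ... | at-x rewrite restrict-x w = ⊥-elim (x≢y (sym (alt-head h)))
  ... | at-y rewrite side-y | restrict-y w = inj₂ (push-y (scan-completeˣ w (alt-tail h)))
  ... | elsewhere z≢x z≢y rewrite side-elsewhere z≢x z≢y | restrict-elsewhere z≢x z≢y w = scan-completeʸ w h

  not-broken : ∀ {s t} → t ≢ broken → s ≡ none ⊎ s ≡ t → s ≢ broken
  not-broken _   (inj₁ refl) ()
  not-broken t≢b (inj₂ refl) = t≢b

  alternate⇒intact : ∀ w → Alternate w x y → scan x y w ≢ broken
  alternate⇒intact w (inj₁ h) = not-broken (λ ()) (scan-completeˣ w h)
  alternate⇒intact w (inj₂ h) = not-broken (λ ()) (scan-completeʸ w h)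

  describes⇒alternate : ∀ s {l} → s ≢ broken → Describes s l → AltFrom x y l ⊎ AltFrom y x l
  describes⇒alternate none    _   refl = inj₁ alt-[]
  describes⇒alternate startsX _   h    = inj₁ h
  describes⇒alternate startsY _   h    = inj₂ h
  describes⇒alternate broken  s≢b _    = ⊥-elim (s≢b refl)

  intact⇒alternate : ∀ w → scan x y w ≢ broken → Alternate w x y
  intact⇒alternate w intact = describes⇒alternate (scan x y w) intact (scan-sound w)

  non-alternate⇒broken : ∀ w → ¬ Alternate w x y → scan x y w ≡ broken
  non-alternate⇒broken w ¬alt =
    decidable-stable (scan x y w ≟ₛ broken) (λ intact → ¬alt (intact⇒alternate w intact))

open ScanCorrect using (alternate⇒intact; non-alternate⇒broken)

module Relabel {n m : ℕ} (f : Fin n → Fin m) where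

  Labels : Fin n → Fin m → Set
  Labels x x′ = ∀ z → f z ≡ x′ ⇔ z ≡ x

  does-relabel : ∀ {x x′} → Labels x x′ → ∀ z → does (f z ≟ x′) ≡ does (z ≟ x)
  does-relabel {x} {x′} lab z with z ≟ x
  ... | yes z≡x = dec-true (f z ≟ x′) (Equivalence.from (lab z) z≡x)
  ... | no  z≢x = dec-false (f z ≟ x′) (z≢x ∘ Equivalence.to (lab z))

  scan-relabel : ∀ {x x′ y y′} → Labels x x′ → Labels y y′ → ∀ w → scan x′ y′ (map f w) ≡ scan x y w
  scan-relabel lx ly []      = refl
  scan-relabel {x} {x′} {y} {y′} lx ly (z ∷ w) = cong₂ push side≡ (scan-relabel lx ly w)
    where
      side≡ : side x′ y′ (f z) ≡ side x y z
      side≡ rewrite does-relabel lx z | does-relabel ly z = refl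

  orient-relabel : ∀ {c c′ x x′ y y′} → Labels c c′ → Labels x x′ → Labels y y′ →
                   ∀ w → orient c′ x′ y′ (map f w) ≡ orient c x y w
  orient-relabel {c} {c′} {x} {x′} {y} {y′} lc lx ly w = cong cyclic (lead-relabel w)
    where
      lead-relabel : ∀ w → lead c′ x′ y′ (map f w) ≡ lead c x y w
      lead-relabel []      = refl
      lead-relabel (z ∷ w) = cong₂ remember rank≡ (lead-relabel w)
        where
          rank≡ : rank c′ x′ y′ (f z) ≡ rank c x y z
          rank≡ rewrite does-relabel lc z | does-relabel lx z | does-relabel ly z = refl

open Relabel using (Labels; scan-relabel; orient-relabel)

-- The position of z in the list vs, or the length of vs if z is not listed.
-- For distinct v₀ … vₘ₋₁ this relabels vᵢ as i and every other letter as m.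
position : ∀ {n m} → Vec (Fin n) m → Fin n → Fin (suc m)
position []       z = zero
position (v ∷ vs) z = if does (z ≟ v) then zero else suc (position vs z)

position-inject : ∀ {n m} (vs : Vec (Fin n) m) i z → position vs z ≡ inject₁ i → z ≡ lookup vs i
position-inject (v ∷ vs) zero z eq with z ≟ v
... | yes z≡v = z≡v
... | no  _   = ⊥-elim (0≢1+n (sym eq))
position-inject (v ∷ vs) (suc i) z eq with z ≟ v
... | yes _ = ⊥-elim (0≢1+n eq)
... | no  _ = position-inject vs i z (suc-injective eq)

position-lookup : ∀ {n m} {vs : Vec (Fin n) m} → AllPairs _≢_ vs → ∀ i → position vs (lookup vs i) ≡ inject₁ i
position-lookup {vs = v ∷ vs} _ zero rewrite dec-true (v ≟ v) refl = refl
position-lookup {vs = v ∷ vs} (v≢vs ∷ distinct) (suc i)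
  rewrite dec-false (lookup vs i ≟ v) (≢-sym (lookup⁺ v≢vs i)) = cong suc (position-lookup distinct i)

position-labels : ∀ {n m} {vs : Vec (Fin n) m} → AllPairs _≢_ vs → ∀ i → Labels (position vs) (lookup vs i) (inject₁ i)
position-labels {vs = vs} distinct i z = mk⇔ (position-inject vs i z) (λ { refl → position-lookup distinct i })

-- The finite verification on words over five letters 0, 1, 2, 3, 4, where 0, 1, 2, 3
-- play the roles of c, a, b, d and 4 stands for every other letter.
Monitor : Set
Monitor = Scan × Scan × Scan × Scan × Scan × List (Fin 3) × List (Fin 3)

monitor : List (Fin 5) → Monitor
monitor u = scan 0F 1F u , scan 0F 3F u , scan 1F 2F u , scan 2F 3F u , scan 1F 3F u
          , lead 0F 1F 2F u , lead 0F 2F 3F u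

-- The transition function: monitor (z ∷ u) ≡ step z (monitor u) holds by definition.
step : Fin 5 → Monitor → Monitor
step z (ca , cd , ab , bd , ad , cab , cbd) =
  push (side 0F 1F z) ca , push (side 0F 3F z) cd , push (side 1F 2F z) ab ,
  push (side 2F 3F z) bd , push (side 1F 3F z) ad ,
  remember (rank 0F 1F 2F z) cab , remember (rank 0F 2F 3F z) cbd

_≟ₘ_ : DecidableEquality Monitor
_≟ₘ_ = ≟ₛ× (≟ₛ× (≟ₛ× (≟ₛ× (≟ₛ× (Product.≡-dec lead-≟ lead-≟)))))
  where
    lead-≟ : DecidableEquality (List (Fin 3))
    lead-≟ = List.≡-dec _≟_
    ≟ₛ× : ∀ {B : Set} → DecidableEquality B → DecidableEquality (Scan × B)
    ≟ₛ× ≟B = Product.≡-dec _≟ₛ_ ≟B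

open import Data.List.Membership.DecPropositional _≟ₘ_ using (_∈_; _∈?_)

Healthy : Monitor → Set
Healthy (ca , cd , ab , bd , _) = ca ≢ broken × cd ≢ broken × ab ≢ broken × bd ≢ broken

healthy? : ∀ s → Dec (Healthy s)
healthy? (ca , cd , ab , bd , _) =
  ¬? (ca ≟ₛ broken) ×-dec ¬? (cd ≟ₛ broken) ×-dec ¬? (ab ≟ₛ broken) ×-dec ¬? (bd ≟ₛ broken)

-- Since broken is absorbing, a healthy state has only healthy predecessors.
healthy-back : ∀ z s → Healthy (step z s) → Healthy s
healthy-back z (ca , cd , ab , bd , _) (h₁ , h₂ , h₃ , h₄) =
  stays (side 0F 1F z) h₁ , stays (side 0F 3F z) h₂ , stays (side 1F 2F z) h₃ , stays (side 2F 3F z) h₄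
  where
    stays : ∀ r {s} → push r s ≢ broken → s ≢ broken
    stays r h refl = h (push-broken r)

-- Breadth-first exploration of the healthy states; seven rounds reach all 51 of them.
successors : Monitor → List Monitor
successors s = filter healthy? (map (λ z → step z s) (allFin 5))

explore : ℕ → List Monitor → List Monitor
explore zero    ms = ms
explore (suc k) ms = explore k (deduplicate _≟ₘ_ (ms ++ concatMap successors ms))

reachable : List Monitor
reachable = explore 7 (monitor [] ∷ [])

ClosedIn : List Monitor → Monitor → Set
ClosedIn R s = All (λ z → Healthy (step z s) → step z s ∈ R) (allFin 5)

closedIn? : ∀ R → Dec (All (ClosedIn R) R)
closedIn? R = all? (λ s → all? (λ z → healthy? (step z s) →-dec (step z s ∈? R)) (allFin 5)) R

Flips : Monitor → Set
Flips (_ , _ , _ , _ , ad , cab , cbd) = ad ≡ broken → cyclic cab ≢ cyclic cbd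

flips? : ∀ s → Dec (Flips s)
flips? (_ , _ , _ , _ , ad , cab , cbd) = (ad ≟ₛ broken) →-dec ¬? (cyclic cab Bool.≟ cyclic cbd)

start-reachable : monitor [] ∈ reachable
start-reachable = toWitness {a? = monitor [] ∈? reachable} _

reachable-closed : All (ClosedIn reachable) reachable
reachable-closed = toWitness {a? = closedIn? reachable} _

reachable-flips : All Flips reachable
reachable-flips = toWitness {a? = all? flips? reachable} _

monitor-reachable : ∀ u → Healthy (monitor u) → monitor u ∈ reachable
monitor-reachable []      _ = start-reachable
monitor-reachable (z ∷ u) h =
  All.lookup (All.lookup reachable-closed (monitor-reachable u (healthy-back z (monitor u) h))) (∈-allFin z) h

orientation-flips₅ : ∀ u → Healthy (monitor u) → scan 1F 3F u ≡ broken → orient 0F 1F 2F u ≢ orient 0F 2F 3F u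
orientation-flips₅ u h = All.lookup reachable-flips (monitor-reachable u h)

-- Relabel w by the roles c, a, b, d ↦ 0, 1, 2, 3 and apply the five-letter case.
orientation-flips : ∀ {n} {c a b d : Fin n} w →
  c ≢ a → c ≢ b → c ≢ d → a ≢ b → a ≢ d → b ≢ d →
  Alternate w c a → Alternate w c d → Alternate w a b → Alternate w b d → ¬ Alternate w a d →
  orient c a b w ≢ orient c b d w
orientation-flips {c = c} {a} {b} {d} w c≢a c≢b c≢d a≢b a≢d b≢d ca cd ab bd ¬ad =
  subst₂ _≢_ (orient-relabel role (lab 0F) (lab 1F) (lab 2F) w) (orient-relabel role (lab 0F) (lab 2F) (lab 3F) w)
    (orientation-flips₅ (map role w)
      (intact 0F 1F c≢a ca , intact 0F 3F c≢d cd , intact 1F 2F a≢b ab , intact 2F 3F b≢d bd)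
      (trans (scan≡ 1F 3F) (non-alternate⇒broken a≢d w ¬ad)))
  where
    vs : Vec (Fin _) 4
    vs = c ∷ a ∷ b ∷ d ∷ []
    role : Fin _ → Fin 5
    role = position vs
    lab : ∀ i → Labels role (lookup vs i) (inject₁ i)
    lab = position-labels ((c≢a ∷ c≢b ∷ c≢d ∷ []) ∷ (a≢b ∷ a≢d ∷ []) ∷ (b≢d ∷ []) ∷ [] ∷ [])
    scan≡ : ∀ i j → scan (inject₁ i) (inject₁ j) (map role w) ≡ scan (lookup vs i) (lookup vs j) w
    scan≡ i j = scan-relabel role (lab i) (lab j) w
    intact : ∀ i j → lookup vs i ≢ lookup vs j → Alternate w (lookup vs i) (lookup vs j) →
             scan (inject₁ i) (inject₁ j) (map role w) ≢ broken
    intact i j ne alt rewrite scan≡ i j = alternate⇒intact ne w alt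

module _ {n : ℕ} (G : Graph n) where

  Adjacent : Fin n → Fin n → Set
  Adjacent x y = Adj G x y ⊎ Adj G y x

  Loopless : Set
  Loopless = ∀ {x} → ¬ Adj G x x

  record Fan (c x y z : Fin n) : Set where
    constructor fan
    field
      spokeˣ    : Adjacent c x
      spokeʸ    : Adjacent c y
      spokeᶻ    : Adjacent c z
      edgeˣʸ    : Adjacent x y
      edgeʸᶻ    : Adjacent y z
      apart     : x ≢ z
      chordless : ¬ Adjacent x z

  FanWalk : Fin n → Fin n → List (Fin n) → Set
  FanWalk c x (y ∷ z ∷ l) = Fan c x y z × FanWalk c y (z ∷ l)
  FanWalk c x _           = ⊤

  -- A wheel with centre c and rim v₀ v₁ vs of odd length: the closed walk around the
  -- rim, extended by v₀ v₁ so that every rim vertex is the middle of a fan.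
  record OddWheel (c v₀ v₁ : Fin n) (vs : List (Fin n)) : Set where
    field
      odd  : parity (length vs) ≡ 1ℙ
      fans : FanWalk c v₀ (v₁ ∷ vs ++ v₀ ∷ v₁ ∷ [])

module _ {n : ℕ} {G : Graph n} (loopless : Loopless G) {w : List (Fin n)} (rep : Represents G w) where

  adjacent⇒≢ : ∀ {x y} → Adjacent G x y → x ≢ y
  adjacent⇒≢ (inj₁ xy) refl = loopless xy
  adjacent⇒≢ (inj₂ yx) refl = loopless yx

  adjacent⇒alternate : ∀ {x y} → Adjacent G x y → Alternate w x y
  adjacent⇒alternate xy = Equivalence.from (proj₂ rep _ _ (adjacent⇒≢ xy)) xy

  fan-flips : ∀ {c x y z} → Fan G c x y z → orient c x y w ≢ orient c y z w
  fan-flips F =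
    orientation-flips w (adjacent⇒≢ spokeˣ) (adjacent⇒≢ spokeʸ) (adjacent⇒≢ spokeᶻ)
      (adjacent⇒≢ edgeˣʸ) apart (adjacent⇒≢ edgeʸᶻ)
      (adjacent⇒alternate spokeˣ) (adjacent⇒alternate spokeᶻ)
      (adjacent⇒alternate edgeˣʸ) (adjacent⇒alternate edgeʸᶻ)
      (chordless ∘ Equivalence.to (proj₂ rep _ _ apart))
    where open Fan F

orients : ∀ {n} → Fin n → List (Fin n) → Fin n → List (Fin n) → List Bool
orients c w x []      = []
orients c w x (y ∷ l) = orient c x y w ∷ orients c w y l

orients-length : ∀ {n} (c : Fin n) w x l → length (orients c w x l) ≡ length l
orients-length c w x []      = refl
orients-length c w x (y ∷ l) = cong suc (orients-length c w y l)

orients-snoc : ∀ {n} (c : Fin n) w x l y z →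
               orients c w x (l ++ y ∷ z ∷ []) ≡ orients c w x (l ++ y ∷ []) ∷ʳ orient c y z w
orients-snoc c w x []      y z = refl
orients-snoc c w x (v ∷ l) y z = cong (orient c x v w ∷_) (orients-snoc c w v l y z)

walk-flips : ∀ {n} {G : Graph n} → Loopless G → ∀ {w} → Represents G w →
             ∀ {c x} l → FanWalk G c x l → Linked _≢_ (orients c w x l)
walk-flips loopless rep []          _        = []
walk-flips loopless rep (y ∷ [])    _        = [-]
walk-flips loopless rep (y ∷ z ∷ l) (F , fans) = fan-flips loopless rep F ∷ walk-flips loopless rep (z ∷ l) fans

two-flips : ∀ {b x y : Bool} → b ≢ x → x ≢ y → b ≡ y
two-flips b≢x x≢y = trans (¬-not b≢x) (sym (¬-not (≢-sym x≢y)))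

closed-flips : ∀ {b : Bool} bs → Linked _≢_ (b ∷ bs ∷ʳ b) → parity (length bs) ≡ 1ℙ
closed-flips []           (b≢b ∷ _)           = ⊥-elim (b≢b refl)
closed-flips (x ∷ [])     _                   = refl
closed-flips (x ∷ y ∷ bs) (b≢x ∷ x≢y ∷ flips) with two-flips b≢x x≢y
... | refl = closed-flips bs flips

parity-suc : ∀ k → parity (suc k) ≢ parity k
parity-suc zero          ()
parity-suc (suc zero)    ()
parity-suc (suc (suc k)) = parity-suc k

-- A loopless graph containing an odd wheel is not word-representable: the k orientations
-- around the rim would form a closed walk in Bool of odd length k changing at every step.
no-odd-wheel : ∀ {n} {G : Graph n} {c v₀ v₁ vs} → Loopless G → OddWheel G c v₀ v₁ vs → ¬ WordRepresentable G
no-odd-wheel {c = c} {v₀} {v₁} {vs} loopless wheel (w , rep) =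
  parity-suc (length vs) (begin
    parity (suc (length vs)) ≡⟨ cong parity (sym bits-length) ⟩
    parity (length bits)     ≡⟨ closed-flips bits bits-flip ⟩
    1ℙ                       ≡⟨ sym odd ⟩
    parity (length vs)       ∎)
  where
    open OddWheel wheel
    open ≡-Reasoning
    bits : List Bool
    bits = orients c w v₁ (vs ++ v₀ ∷ [])
    bits-flip : Linked _≢_ (orient c v₀ v₁ w ∷ bits ∷ʳ orient c v₀ v₁ w)
    bits-flip = subst (Linked _≢_) (orients-snoc c w v₀ (v₁ ∷ vs) v₀ v₁) (walk-flips loopless rep _ fans)
    bits-length : length bits ≡ suc (length vs)
    bits-length = begin
      length bits              ≡⟨ orients-length c w v₁ (vs ++ v₀ ∷ []) ⟩
      length (vs ++ v₀ ∷ [])   ≡⟨ length-++ vs ⟩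
      length vs + 1            ≡⟨ +-comm (length vs) 1 ⟩
      suc (length vs)          ∎

t₁-loopless : Loopless T₁
t₁-loopless (grid ())

t₂-loopless : Loopless T₂
t₂-loopless (grid ())

t₁-wheel : OddWheel T₁ 4F 1F 3F (6F ∷ 7F ∷ 5F ∷ [])
t₁-wheel = record
  { odd  = refl
  ; fans =
      fan 5~2 5~4 5~7 (inj₁ e24) (inj₁ (grid e47)) (λ ()) (λ { (inj₁ (grid ())) ; (inj₂ (grid ())) }) ,
      fan 5~4 5~7 5~8 (inj₁ (grid e47)) (inj₁ (grid e78)) (λ ()) (λ { (inj₁ (grid ())) ; (inj₂ (grid ())) }) ,
      fan 5~7 5~8 5~6 (inj₁ (grid e78)) (inj₂ e68) (λ ()) (λ { (inj₁ (grid ())) ; (inj₂ (grid ())) }) ,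
      fan 5~8 5~6 5~2 (inj₂ e68) (inj₂ e26) (λ ()) (λ { (inj₁ (grid ())) ; (inj₂ (grid ())) }) ,
      fan 5~6 5~2 5~4 (inj₂ e26) (inj₁ e24) (λ ()) (λ { (inj₁ (grid ())) ; (inj₂ (grid ())) }) ,
      tt
  }
  where
    5~2 : Adjacent T₁ 4F 1F
    5~2 = inj₂ (grid e25)
    5~4 : Adjacent T₁ 4F 3F
    5~4 = inj₂ (grid e45)
    5~6 : Adjacent T₁ 4F 5F
    5~6 = inj₁ (grid e56)
    5~7 : Adjacent T₁ 4F 6F
    5~7 = inj₁ e57
    5~8 : Adjacent T₁ 4F 7F
    5~8 = inj₁ (grid e58)

t₂-wheel : OddWheel T₂ 4F 0F 1F (2F ∷ 5F ∷ 8F ∷ 7F ∷ 3F ∷ [])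
t₂-wheel = record
  { odd  = refl
  ; fans =
      fan 5~1 5~2 5~3 (inj₁ (grid e12)) (inj₁ (grid e23)) (λ ()) (λ { (inj₁ (grid ())) ; (inj₂ (grid ())) }) ,
      fan 5~2 5~3 5~6 (inj₁ (grid e23)) (inj₁ (grid e36)) (λ ()) (λ { (inj₁ (grid ())) ; (inj₂ (grid ())) }) ,
      fan 5~3 5~6 5~9 (inj₁ (grid e36)) (inj₁ (grid e69)) (λ ()) (λ { (inj₁ (grid ())) ; (inj₂ (grid ())) }) ,
      fan 5~6 5~9 5~8 (inj₁ (grid e69)) (inj₂ (grid e89)) (λ ()) (λ { (inj₁ (grid ())) ; (inj₂ (grid ())) }) ,
      fan 5~9 5~8 5~4 (inj₂ (grid e89)) (inj₂ e48) (λ ()) (λ { (inj₁ (grid ())) ; (inj₂ (grid ())) }) ,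
      fan 5~8 5~4 5~1 (inj₂ e48) (inj₂ (grid e14)) (λ ()) (λ { (inj₁ (grid ())) ; (inj₂ (grid ())) }) ,
      fan 5~4 5~1 5~2 (inj₂ (grid e14)) (inj₁ (grid e12)) (λ ()) (λ { (inj₁ (grid ())) ; (inj₂ (grid ())) }) ,
      tt
  }
  where
    5~1 : Adjacent T₂ 4F 0F
    5~1 = inj₂ e15
    5~2 : Adjacent T₂ 4F 1F
    5~2 = inj₂ (grid e25)
    5~3 : Adjacent T₂ 4F 2F
    5~3 = inj₂ e35
    5~4 : Adjacent T₂ 4F 3F
    5~4 = inj₂ (grid e45)
    5~6 : Adjacent T₂ 4F 5F
    5~6 = inj₁ (grid e56)
    5~8 : Adjacent T₂ 4F 7F
    5~8 = inj₁ (grid e58)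
    5~9 : Adjacent T₂ 4F 8F
    5~9 = inj₁ e59

theorem4 : ¬ WordRepresentable T₁ × ¬ WordRepresentable T₂
theorem4 = no-odd-wheel t₁-loopless t₁-wheel , no-odd-wheel t₂-loopless t₂-wheel
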